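{- Let $a,b\in\mathbf{V}$, let $f:a\to b$ be a function in $\mathbf{V}$, and let $\hat f=\{(\mathrm{op}(\mathfrak{r}(c),\mathfrak{r}(f(c))),\pi):c\in a,\ \pi\in\Pi\}$. Then $\mathsf{I}\Vdash\forall x^{\mathfrak{r}(a)}\,\forall y\,(y\not\varepsilon\,\mathfrak{r}(b)\to\mathrm{op}(x,y)\not\varepsilon\,\hat f)$, where $\mathsf{I}=\lambda u.u$.
   Context: Setting (Krivine realizability) over a model $\mathbf{V}$ of ZF with realizability algebra $(\Lambda,\Pi,\succ,\perp\!\!\!\perp)$: $\Lambda$ closed $\lambda_c$-terms (variables, application, abstraction, $\mathsf{cc}$, continuation constants $\mathsf{k}_\pi$, possibly special instructions), $\Pi$ stacks (stack bottoms and $t\cdot\pi$), $\succ$ a preorder on processes containing $ts\star\pi\succ t\star s\cdot\pi$, $\lambda u.t\star s\cdot\pi\succ t[u:=s]\star\pi$, $\mathsf{cc}\star t\cdot\pi\succ t\star\mathsf{k}_\pi\cdot\pi$, $\mathsf{k}_\sigma\star t\cdot\pi\succ t\star\sigma$; pole $\perp\!\!\!\perp$ closed under anti-reduction. Church numerals $\underline0=\lambda u.\lambda v.v$, $\underline1=\lambda u.\lambda v.uv$. Names $\mathbf{N}=\bigcup_\alpha\mathbf{N}_\alpha$, $\mathbf{N}_\alpha=\bigcup_{\beta<\alpha}\mathcal{P}(\mathbf{N}_\beta\times\Pi)$, $\mathrm{dom}(a)=\{b:\exists\pi(b,\pi)\in a\}$. Falsity values: $\|a\not\varepsilon b\|=\{\pi:(a,\pi)\in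 b\}$, $\|\varphi\to\psi\|=\{t\cdot\pi:t\Vdash\varphi,\pi\in\|\psi\|\}$, $\|\forall x\varphi\|=\bigcup_{a\in\mathbf{N}}\|\varphi(a)\|$, restricted quantifier $\|\forall x^{c}\varphi(x)\|=\bigcup_{d\in\mathrm{dom}(c)}\|\varphi(d)\|$; $t\Vdash\varphi$ iff $t\star\pi\in\perp\!\!\!\perp$ for all $\pi\in\|\varphi\|$. Reish: $\mathfrak{r}(x)=\{(\mathfrak{r}(y),\pi):y\in x,\pi\in\Pi\}$. Operations: $\mathrm{sng}(a)=\{a\}\times\Pi$; $\mathrm{up}(a,b)=\{(a,\underline0\cdot\pi):\pi\in\Pi\}\cup\{(b,\underline1\cdot\pi):\pi\in\Pi\}$; $\mathrm{op}(a,b)=\mathrm{up}(\mathrm{up}(\mathrm{sng}(a),\mathfrak{r}(0)),\mathrm{sng}(\mathrm{sng}(b)))$; evaluated on parameters in $\mathbf{V}$. -}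

module Defs where

open import Level using (Level; Lift; lift)
open import Data.Nat using (ℕ; zero; suc)
open import Data.Fin using (Fin; zero; suc)
open import Data.Bool using (Bool; true; false)
open import Data.Empty using (⊥)
open import Data.Product using (Σ; _×_; _,_; proj₁; proj₂)
open import Relation.Binary.PropositionalEquality using (_≡_)

-- λc-terms and stacks (Krivine), over stack bottoms B and special
-- instructions Inst.  Terms use de Bruijn indices; Λ = Term B Inst 0.

mutual
  data Term (B Inst : Set) (n : ℕ) : Set where
    var : Fin n → Term B Inst n
    app : Term B Inst n → Term B Inst n → Term B Inst n
    lam : Term B Inst (suc n) → Term B Inst n
    cc  : Term B Inst n
    kk  : Stack B Inst → Term B Inst n
    ins : Inst → Term B Inst n

  data Stack (B Inst : Set) : Set where
    bot : B → Stack B Inst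
    _∷_ : Term B Inst 0 → Stack B Inst → Stack B Inst

infixr 5 _∷_

module _ {B Inst : Set} where

  rename : ∀ {n m} → (Fin n → Fin m) → Term B Inst n → Term B Inst m
  rename ρ (var x)   = var (ρ x)
  rename ρ (app t s) = app (rename ρ t) (rename ρ s)
  rename ρ (lam t)   = lam (rename (ext ρ) t)
    where
    ext : ∀ {n m} → (Fin n → Fin m) → Fin (suc n) → Fin (suc m)
    ext ρ zero    = zero
    ext ρ (suc x) = suc (ρ x)
  rename ρ cc        = cc
  rename ρ (kk π)    = kk π
  rename ρ (ins i)   = ins i

  subst : ∀ {n m} → (Fin n → Term B Inst m) → Term B Inst n → Term B Inst m
  subst σ (var x)   = σ x
  subst σ (app t s) = app (subst σ t) (subst σ s)
  subst σ (lam t)   = lam (subst exts t)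
    where
    exts : Fin (suc _) → Term B Inst (suc _)
    exts zero    = var zero
    exts (suc x) = rename suc (σ x)
  subst σ cc        = cc
  subst σ (kk π)    = kk π
  subst σ (ins i)   = ins i

  _[_] : Term B Inst 1 → Term B Inst 0 → Term B Inst 0
  t [ s ] = subst (λ { zero → s }) t

  infix 4 _⋆_
  record Process : Set where
    constructor _⋆_
    field
      term  : Term B Inst 0
      stack : Stack B Inst

  𝟘 𝟙 I : Term B Inst 0
  𝟘 = lam (lam (var zero))
  𝟙 = lam (lam (app (var (suc zero)) (var zero)))
  I = lam (var zero)


record RealizAlg (B Inst : Set) : Set₁ where
  field
    _≻_      : Process {B} {Inst} → Process → Set
    ≻-refl   : ∀ {p} → p ≻ p
    ≻-trans  : ∀ {p q r} → p ≻ q → q ≻ r → p ≻ r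
    ≻-push   : ∀ t s π → (app t s ⋆ π) ≻ (t ⋆ (s ∷ π))
    ≻-grab   : ∀ t s π → (lam t ⋆ (s ∷ π)) ≻ ((t [ s ]) ⋆ π)
    ≻-save   : ∀ t π → (cc ⋆ (t ∷ π)) ≻ (t ⋆ (kk π ∷ π))
    ≻-restore : ∀ σ t π → (kk σ ⋆ (t ∷ π)) ≻ (t ⋆ σ)
    ⫫        : Process {B} {Inst} → Set
    ⫫-anti   : ∀ {p q} → p ≻ q → ⫫ q → ⫫ p

-- The ground model V: Aczel-style iterative sets with extensional
-- equality and membership.

data 𝕍 : Set₁ where
  sup : (A : Set) → (A → 𝕍) → 𝕍

_≐_ : 𝕍 → 𝕍 → Set
sup A α ≐ sup B β =
  ((i : A) → Σ B λ j → α i ≐ β j) × ((j : B) → Σ A λ i → α i ≐ β j)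

_∈V_ : 𝕍 → 𝕍 → Set
x ∈V sup B β = Σ B λ j → x ≐ β j

∅V : 𝕍
∅V = sup ⊥ (λ ())

-- A function f : a → b in V (a set-function on the elements of a,
-- respecting extensional equality, with values in b).
SetFun : 𝕍 → 𝕍 → Set₁
SetFun (sup A α) b =
  Σ (A → 𝕍) λ f →
    ((i : A) → f i ∈V b) × ((i j : A) → α i ≐ α j → f i ≐ f j)

-- Names: sets of pairs (name , stack), with extensional equality.

module Names {B Inst : Set} where

  Π = Stack B Inst
  Λ = Term B Inst 0

  data Name : Set₁ where
    nm : (X : Set) → (X → Name) → (X → Π) → Name

  _≐ₙ_ : Name → Name → Set
  nm X e s ≐ₙ nm Y e' s' =
    ((i : X) → Σ Y λ j → (e i ≐ₙ e' j) × (s i ≡ s' j)) ×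
    ((j : Y) → Σ X λ i → (e i ≐ₙ e' j) × (s i ≡ s' j))

  _,_∈ₙ_ : Name → Π → Name → Set
  a , π ∈ₙ nm X e s = Σ X λ i → (a ≐ₙ e i) × (π ≡ s i)

  𝔯 : 𝕍 → Name
  𝔯 (sup A α) = nm (A × Π) (λ p → 𝔯 (α (proj₁ p))) proj₂

  sng : Name → Name
  sng a = nm Π (λ _ → a) (λ π → π)

  up : Name → Name → Name
  up a b = nm (Bool × Π) (λ { (true , _) → a ; (false , _) → b })
                         (λ { (true , π) → 𝟘 ∷ π ; (false , π) → 𝟙 ∷ π })

  op : Name → Name → Name
  op a b = up (up (sng a) (𝔯 ∅V)) (sng (sng b))

  fhat : (a b : 𝕍) → SetFun a b → Name
  fhat (sup A α) b (f , _) =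
    nm (A × Π) (λ p → op (𝔯 (α (proj₁ p))) (𝔯 (f (proj₁ p)))) proj₂

  Fal : Set₂
  Fal = Π → Set₁

  ‖_∉_‖ : Name → Name → Fal
  ‖ a ∉ b ‖ π = Lift _ (a , π ∈ₙ b)

  module Real (K : RealizAlg B Inst) where
    open RealizAlg K

    _⊩_ : Λ → Fal → Set₁
    t ⊩ F = ∀ π → F π → ⫫ (t ⋆ π)

    infixr 3 _⇒_
    _⇒_ : Fal → Fal → Fal
    (F ⇒ G) σ = Σ Λ λ t → Σ Π λ π → (σ ≡ t ∷ π) × (t ⊩ F) × G π

    ∀ₙ : (Name → Fal) → Fal
    ∀ₙ φ σ = Σ Name λ a → φ a σ

    ∀^ : Name → (Name → Fal) → Fal
    ∀^ (nm X e s) φ σ = Σ X λ i → φ (e i) σ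

{-# OPTIONS --safe #-}
module Submission where

-- The realizer I only has to pass its argument t on to the stack π: if (op x y , π) ∈ f̂, then
-- op x y ≐ op (𝔯 c) (𝔯 (f c)) for some c ∈ a, and the second component of the pair op can be
-- recovered up to extensional equality, so y ≐ 𝔯 (f c).  As f c ∈ b, this gives (y , π) ∈ 𝔯 b,
-- which is exactly what t ⊩ y ∉ 𝔯 b is tested against.

open import Defs
open import Level using (lift)
open import Data.Fin using (zero)
open import Data.Bool using (true; false)
open import Data.Product using (_,_; proj₁; proj₂)
open import Relation.Binary.PropositionalEquality using (refl; trans)

module _ {B Inst : Set} where
  open Names {B} {Inst}

  ≐ₙ-trans : ∀ {x y z} → x ≐ₙ y → y ≐ₙ z → x ≐ₙ z
  ≐ₙ-trans {nm X e s} {nm Y e′ s′} {nm Z e″ s″} (x⊆y , y⊆x) (y⊆z , z⊆y) =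
    (λ i → let j , eᵢ≐eⱼ , sᵢ≡sⱼ = x⊆y i
               k , eⱼ≐eₖ , sⱼ≡sₖ = y⊆z j
           in k , ≐ₙ-trans {e i} {e′ j} {e″ k} eᵢ≐eⱼ eⱼ≐eₖ , trans sᵢ≡sⱼ sⱼ≡sₖ) ,
    (λ k → let j , eⱼ≐eₖ , sⱼ≡sₖ = z⊆y k
               i , eᵢ≐eⱼ , sᵢ≡sⱼ = y⊆x j
           in i , ≐ₙ-trans {e i} {e′ j} {e″ k} eᵢ≐eⱼ eⱼ≐eₖ , trans sᵢ≡sⱼ sⱼ≡sₖ)

  ∈ₙ-resp-≐ₙ : ∀ {x y π c} → x ≐ₙ y → y , π ∈ₙ c → x , π ∈ₙ c
  ∈ₙ-resp-≐ₙ {c = nm X e s} x≐y (i , y≐eᵢ , π≡sᵢ) = i , ≐ₙ-trans x≐y y≐eᵢ , π≡sᵢ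

  𝔯-cong : ∀ {u v} → u ≐ v → 𝔯 u ≐ₙ 𝔯 v
  𝔯-cong {sup A α} {sup C β} (u⊆v , v⊆u) =
    (λ { (i , π) → let j , αᵢ≐βⱼ = u⊆v i in (j , π) , 𝔯-cong αᵢ≐βⱼ , refl }) ,
    (λ { (j , π) → let i , αᵢ≐βⱼ = v⊆u j in (i , π) , 𝔯-cong αᵢ≐βⱼ , refl })

  𝔯-∈ : ∀ {u v} → u ∈V v → ∀ π → 𝔯 u , π ∈ₙ 𝔯 v
  𝔯-∈ {v = sup C β} (j , u≐βⱼ) π = (j , π) , 𝔯-cong u≐βⱼ , refl

  -- An inhabitant of Π is needed: without stacks every sng is empty.
  sng-injective : Π → ∀ {x y} → sng x ≐ₙ sng y → x ≐ₙ y
  sng-injective π (x⊆y , _) = proj₁ (proj₂ (x⊆y π))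

  -- The tag 𝟙 ∷ π of the second component cannot match the tag 𝟘 ∷ π′ of the first.
  op-injectiveʳ : Π → ∀ {x y x′ y′} → op x y ≐ₙ op x′ y′ → y ≐ₙ y′
  op-injectiveʳ π (op⊆op′ , _) with op⊆op′ (false , π)
  ... | (true  , _) , _ , ()
  ... | (false , _) , sng²y≐sng²y′ , _ =
    sng-injective π (sng-injective π sng²y≐sng²y′)

  op∈fhat⇒∈𝔯 : ∀ a b (f : SetFun a b) {x y π} →
               op x y , π ∈ₙ fhat a b f → y , π ∈ₙ 𝔯 b
  op∈fhat⇒∈𝔯 (sup A α) b (f , f∈b , _) {π = π} ((c , _) , opxy≐opcfc , refl) =
    ∈ₙ-resp-≐ₙ (op-injectiveʳ π opxy≐opcfc) (𝔯-∈ (f∈b c) π)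

  module _ (K : RealizAlg B Inst) where
    open RealizAlg K
    open Real K

    ⊩-∀ₙ : ∀ {t φ} → (∀ x → t ⊩ φ x) → t ⊩ ∀ₙ φ
    ⊩-∀ₙ t⊩φ π (x , π∈φx) = t⊩φ x π π∈φx

    ⊩-∀^ : ∀ {t} c {φ} → (∀ x → t ⊩ φ x) → t ⊩ ∀^ c φ
    ⊩-∀^ (nm X e s) t⊩φ π (i , π∈φeᵢ) = t⊩φ (e i) π π∈φeᵢ

    I-⊩-⇒ : ∀ {F G : Fal} → (∀ {π} → G π → F π) → I ⊩ (F ⇒ G)
    I-⊩-⇒ G⊆F .(t ∷ π) (t , π , refl , t⊩F , π∈G) =
      ⫫-anti (≻-grab (var zero) t π) (t⊩F π (G⊆F π∈G))

proposition16p4 : (B Inst : Set) (K : RealizAlg B Inst) (a b : 𝕍) (f : SetFun a b) →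
    let open Names {B} {Inst} in
    let open Real K in
    I ⊩ ∀^ (𝔯 a) (λ x → ∀ₙ (λ y → ‖ y ∉ 𝔯 b ‖ ⇒ ‖ op x y ∉ fhat a b f ‖))
proposition16p4 B Inst K a b f =
  ⊩-∀^ K (𝔯 a) λ x → ⊩-∀ₙ K λ y →
    I-⊩-⇒ K λ { (lift opxy∈f̂) → lift (op∈fhat⇒∈𝔯 a b f opxy∈f̂) }
  where open Names {B} {Inst}
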